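{- Let $G_1$ be a traceable graph and $G_2$ a connected graph. Consider the statements: (a) $G_2$ has a perfect matching and $|V(G_1)|\geq \Delta(G_2)$; (b) $G_2$ has a path factor and $|V(G_1)|$ is an even integer with $|V(G_1)|\geq 4\Delta(G_2)-2$. If (a) holds or (b) holds, then the Cartesian product $G_1\square G_2$ has a Hamiltonian cycle.
   Context: All graphs are finite and simple. A graph is traceable if it has a spanning path, and Hamiltonian if it has a spanning cycle. The Cartesian product $G_1\square G_2$ has vertex set $\{v_u : v\in V(G_1), u\in V(G_2)\}$, with $v_u v_w$ an edge whenever $uw\in E(G_2)$, and $v_u w_u$ an edge whenever $vw\in E(G_1)$. $\Delta(G)$ denotes the maximum degree of $G$. A path factor of a graph is a spanning subgraph each of whose components is a path with at least two vertices; a perfect matching is a path factor all of whose components are single edges. -}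

module Defs where

open import Data.Nat using (ℕ; zero; suc; _≤_; _⊔_; _+_)
open import Data.Bool using (Bool; true; false; if_then_else_)
open import Data.Fin using (Fin)
open import Data.List using (List; []; _∷_; length; map; foldr; allFin; concat; last)
open import Data.List.Membership.Propositional using (_∈_)
open import Data.List.Relation.Unary.All using (All)
open import Data.List.Relation.Unary.Linked using (Linked)
open import Data.List.Relation.Unary.Unique.Propositional using (Unique)
open import Data.Nat.ListAction using (sum)
open import Data.Maybe using (Maybe; just; nothing)
open import Data.Product using (_×_; Σ; ∃; ∃-syntax; _,_)
open import Data.Sum using (_⊎_)
open import Data.Unit using (⊤)
open import Relation.Binary.PropositionalEquality using (_≡_)

record Graph : Set where
  field
    n      : ℕ
    adj    : Fin n → Fin n → Bool
    sym    : ∀ u v → adj u v ≡ adj v u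
    irrefl : ∀ v → adj v v ≡ false

open Graph public

∣V∣ : Graph → ℕ
∣V∣ G = n G

Edge : (G : Graph) → Fin (n G) → Fin (n G) → Set
Edge G u v = adj G u v ≡ true

-- degree and maximum degree Δ(G) (Δ of the null graph is 0)
degree : (G : Graph) → Fin (n G) → ℕ
degree G v = sum (map (λ w → if adj G v w then 1 else 0) (allFin (n G)))

Δ : Graph → ℕ
Δ G = foldr _⊔_ 0 (map (degree G) (allFin (n G)))

IsPath : {V : Set} → (V → V → Set) → List V → Set
IsPath E []      = ⊥'
  where open import Data.Empty using () renaming (⊥ to ⊥')
IsPath E (x ∷ p) = Unique (x ∷ p) × Linked E (x ∷ p)

Spanning : {V : Set} → List V → Set
Spanning {V} p = (v : V) → v ∈ p

IsCycle : {V : Set} → (V → V → Set) → List V → Set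
IsCycle E []      = ⊥'
  where open import Data.Empty using () renaming (⊥ to ⊥')
IsCycle E (x ∷ p) =
  3 ≤ length (x ∷ p) × Unique (x ∷ p) × Linked E (x ∷ p) ×
  closing (last (x ∷ p))
  where
  closing : Maybe _ → Set
  closing (just y) = E y x
  closing nothing  = ⊤

TraceableRel : {V : Set} → (V → V → Set) → Set
TraceableRel {V} E = Σ (List V) λ p → IsPath E p × Spanning p

HamiltonianRel : {V : Set} → (V → V → Set) → Set
HamiltonianRel {V} E = Σ (List V) λ c → IsCycle E c × Spanning c

Traceable : Graph → Set
Traceable G = TraceableRel (Edge G)

Hamiltonian : Graph → Set
Hamiltonian G = HamiltonianRel (Edge G)

Connected : Graph → Set
Connected G =
  Fin (n G) ×
  ((u v : Fin (n G)) → Σ (List (Fin (n G))) λ p →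
     IsPath (Edge G) p × Data.List.head p ≡ just u × last p ≡ just v)
  where import Data.List

-- A path factor: the vertex set is partitioned into (vertex sets of)
-- paths of G with at least two vertices each; the spanning subgraph is the
-- union of these paths.
PathFactor : Graph → Set
PathFactor G = Σ (List (List (Fin (n G)))) λ ps →
  All (λ p → IsPath (Edge G) p × 2 ≤ length p) ps ×
  Unique (concat ps) × Spanning (concat ps)

PerfectMatching : Graph → Set
PerfectMatching G = Σ (List (List (Fin (n G)))) λ ps →
  All (λ p → IsPath (Edge G) p × length p ≡ 2) ps ×
  Unique (concat ps) × Spanning (concat ps)

□Edge : (G₁ G₂ : Graph) → (Fin (n G₁) × Fin (n G₂)) → (Fin (n G₁) × Fin (n G₂)) → Set
□Edge G₁ G₂ (v , u) (v' , w) =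
  (v ≡ v' × Edge G₂ u w) ⊎ (u ≡ w × Edge G₁ v v')

□Hamiltonian : Graph → Graph → Set
□Hamiltonian G₁ G₂ = HamiltonianRel (□Edge G₁ G₂)

{-# OPTIONS --safe #-}
module Submission where

-- Following the spanning path of G₁ row by row, the grid P_m □ G₂ (m = |V(G₁)|) is a spanning
-- subgraph of G₁ □ G₂, so it suffices to find a Hamiltonian cycle of the grid. Cut G₂ into
-- vertex-disjoint blocks, each an edge or a path on three vertices, and take a Hamiltonian cycle
-- of P_m □ block for each: a ladder for an edge, and for a three-vertex path (m even) a braid
-- whose vertical edges alternate between the columns. Then absorb the blocks one at a time along
-- edges xy of the connected graph G₂: if at some row i the current cycle uses the vertical edge
-- (i,x)(i+1,x) and the block cycle uses (i,y)(i+1,y), replacing these two edges by (i,x)(i,y)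
-- and (i+1,x)(i+1,y) merges the two cycles. Every join at x consumes one row at x and x has at
-- most Δ - 1 neighbours outside its own block, so a fresh row exists as soon as any two vertices
-- have Δ - 1 rows in common on which their block cycles go vertically. For a ladder this holds
-- when m ≥ Δ; for braids it needs m ≥ 4Δ - 2.

open import Data.Bool using (Bool; true; false; T; if_then_else_)
open import Data.Bool.Properties using (T?)
open import Data.Empty using (⊥; ⊥-elim)
open import Data.Fin as Fin using (Fin)
open import Data.List
  using (List; []; _∷_; _++_; [_]; length; map; foldr; concat; concatMap; reverse; filter; last;
         applyUpTo; upTo; allFin; cartesianProduct)
open import Data.List.Properties
  using (++-assoc; ++-identityʳ; map-++; length-++; length-map; length-tabulate; length-upTo;
         length-applyUpTo; applyUpTo-∷ʳ; unfold-reverse; concatMap-++)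
open import Data.List.Membership.Propositional using (_∈_; _∉_; find; lose)
open import Data.List.Membership.Propositional.Properties
  using (∈-++⁺ˡ; ∈-++⁺ʳ; ∈-++⁻; ∈-∃++; ∈-map⁺; ∈-allFin; ∈-filter⁺; ∈-concatMap⁻; ∈-upTo⁺; ∈-upTo⁻;
         ∈-applyUpTo⁻; ∈-cartesianProduct⁺; ∈-cartesianProduct⁻)
import Data.List.Membership.DecPropositional as DecMembership
open import Data.List.Relation.Unary.Any using (here; there; any?)
open import Data.List.Relation.Unary.All as All using (All; []; _∷_)
import Data.List.Relation.Unary.All.Properties as All
open import Data.List.Relation.Unary.AllPairs using ([]; _∷_)
open import Data.List.Relation.Unary.Linked as Linked using (Linked; []; [-]; _∷_)
import Data.List.Relation.Unary.Linked.Properties as Linked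
open import Data.List.Relation.Unary.Unique.Propositional using (Unique)
import Data.List.Relation.Unary.Unique.Propositional.Properties as Unique
open import Data.List.Relation.Binary.Disjoint.Propositional using (Disjoint)
open import Data.List.Relation.Binary.Permutation.Propositional
  using (_↭_; ↭-refl; ↭-sym; ↭-trans; prep; swap; ↭⇒↭ₛ; module PermutationReasoning)
import Data.List.Relation.Binary.Permutation.Propositional.Properties as ↭
import Data.List.Relation.Binary.Permutation.Setoid.Properties as Permutationₛ
open import Data.Maybe using (just)
open import Data.Nat using (ℕ; zero; suc; _+_; _*_; _∸_; _⊔_; _≤_; _<_; z≤n; s≤s; _<?_)
import Data.Nat as ℕ
open import Data.Nat.Divisibility using (_∣_; divides)
open import Data.Nat.ListAction using (sum)
open import Data.Nat.Properties
  using (≤-trans; ≤-reflexive; ≤-antisym; ≤-pred; <-trans; <-≤-trans; <-irrefl; <⇒≤; <⇒≢; ≮⇒≥;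
         n<1+n; m<1+n⇒m<n∨m≡n; m<n⇒m<1+n; m≤m+n; m≤n+m∸n; m≤m⊔n; m≤n⇒m≤o⊔n; +-monoʳ-<; *-suc; *-cancelʳ-≤;
         suc-injective; module ≤-Reasoning)
open import Data.Nat.Tactic.RingSolver using (solve-∀)
open import Data.Product using (Σ; ∃; ∃₂; _×_; _,_; proj₁; proj₂)
import Data.Product as Product
open import Data.Sum using (_⊎_; inj₁; inj₂)
import Data.Sum as Sum
open import Data.Unit using (⊤; tt)
open import Function using (_∘_; id)
open import Relation.Binary.Definitions using (DecidableEquality)
open import Relation.Binary.PropositionalEquality as ≡
  using (_≡_; _≢_; refl; sym; trans; subst; cong; cong₂; module ≡-Reasoning)
open import Relation.Nullary using (¬_; yes; no)
open import Relation.Nullary.Decidable using (¬?)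
open import Relation.Unary using (Decidable)
open import Defs hiding (sym)

module _ {A : Set} where

  lastOf : A → List A → A
  lastOf x []       = x
  lastOf _ (y ∷ ys) = lastOf y ys

  lastOf-++ : ∀ (x : A) xs y ys → lastOf x (xs ++ y ∷ ys) ≡ lastOf y ys
  lastOf-++ x []       y ys = refl
  lastOf-++ x (z ∷ xs) y ys = lastOf-++ z xs y ys

  last≡lastOf : ∀ (x : A) xs → last (x ∷ xs) ≡ just (lastOf x xs)
  last≡lastOf x []       = refl
  last≡lastOf x (y ∷ ys) = last≡lastOf y ys

  data Consecutive : List A → A → A → Set where
    this : ∀ {x y zs} → Consecutive (x ∷ y ∷ zs) x y
    next : ∀ {z xs x y} → Consecutive xs x y → Consecutive (z ∷ xs) x y

  -- The closing edge of a cycle is not a Link of its vertex list.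
  Link : List A → A → A → Set
  Link xs x y = Consecutive xs x y ⊎ Consecutive xs y x

  SameEdge : A → A → A → A → Set
  SameEdge a b p q = (a ≡ p × b ≡ q) ⊎ (a ≡ q × b ≡ p)

  SameEdge-flip : ∀ {a b p q} → SameEdge a b p q → SameEdge a b q p
  SameEdge-flip = Sum.swap

  Consecutive-++ˡ : ∀ {xs ys x y} → Consecutive xs x y → Consecutive (xs ++ ys) x y
  Consecutive-++ˡ this     = this
  Consecutive-++ˡ (next c) = next (Consecutive-++ˡ c)

  Consecutive-++ʳ : ∀ xs {ys x y} → Consecutive ys x y → Consecutive (xs ++ ys) x y
  Consecutive-++ʳ []       c = c
  Consecutive-++ʳ (_ ∷ xs) c = next (Consecutive-++ʳ xs c)

  Consecutive-across : ∀ x xs y ys → Consecutive ((x ∷ xs) ++ y ∷ ys) (lastOf x xs) y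
  Consecutive-across x []       y ys = this
  Consecutive-across x (z ∷ xs) y ys = next (Consecutive-across z xs y ys)

  Consecutive-∈ : ∀ {xs x y} → Consecutive xs x y → x ∈ xs
  Consecutive-∈ this     = here refl
  Consecutive-∈ (next c) = there (Consecutive-∈ c)

  Consecutive-functional : ∀ {xs x y y′} → Unique xs →
                           Consecutive xs x y → Consecutive xs x y′ → y ≡ y′
  Consecutive-functional _          this     this     = refl
  Consecutive-functional (x∉ ∷ _)   this     (next c) = ⊥-elim (All.lookup x∉ (Consecutive-∈ c) refl)
  Consecutive-functional (x∉ ∷ _)   (next c) this     = ⊥-elim (All.lookup x∉ (Consecutive-∈ c) refl)
  Consecutive-functional (_ ∷ xs!)  (next c) (next d) = Consecutive-functional xs! c d

  Consecutive-split : ∀ {xs x y} → Consecutive xs x y → ∃₂ λ l r → xs ≡ l ++ x ∷ y ∷ r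
  Consecutive-split this = [] , _ , refl
  Consecutive-split {z ∷ _} (next c) with Consecutive-split c
  ... | l , r , refl = z ∷ l , r , refl

  Consecutive-cut : ∀ l {u w a b} → Consecutive (l ++ u ∷ w) a b → a ≢ u →
                    Consecutive (l ++ [ u ]) a b ⊎ Consecutive w a b
  Consecutive-cut []          this     a≢u = ⊥-elim (a≢u refl)
  Consecutive-cut []          (next c) _   = inj₂ c
  Consecutive-cut (_ ∷ [])    this     _   = inj₁ this
  Consecutive-cut (_ ∷ _ ∷ _) this     _   = inj₁ this
  Consecutive-cut (_ ∷ l)     (next c) a≢u = Sum.map₁ next (Consecutive-cut l c a≢u)

  Consecutive-reverse : ∀ {xs x y} → Consecutive xs x y → Consecutive (reverse xs) y x
  Consecutive-reverse {x ∷ y ∷ zs} this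
    rewrite unfold-reverse x (y ∷ zs) | unfold-reverse y zs | ++-assoc (reverse zs) [ y ] [ x ]
    = Consecutive-++ʳ (reverse zs) this
  Consecutive-reverse {z ∷ xs} (next c)
    rewrite unfold-reverse z xs = Consecutive-++ˡ (Consecutive-reverse c)

  module _ {R : A → A → Set} where

    Linked-join : ∀ {x xs y ys} → Linked R (x ∷ xs) → R (lastOf x xs) y →
                  Linked R (y ∷ ys) → Linked R ((x ∷ xs) ++ y ∷ ys)
    Linked-join {xs = []}    [-]        r l = r ∷ l
    Linked-join {xs = _ ∷ _} (r′ ∷ l′) r l = r′ ∷ Linked-join l′ r l

    Linked-prefix : ∀ xs {ys} → Linked R (xs ++ ys) → Linked R xs
    Linked-prefix []          _       = []
    Linked-prefix (_ ∷ [])    _       = [-]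
    Linked-prefix (_ ∷ _ ∷ xs) (r ∷ l) = r ∷ Linked-prefix (_ ∷ xs) l

    Linked-suffix : ∀ xs {ys} → Linked R (xs ++ ys) → Linked R ys
    Linked-suffix []           l       = l
    Linked-suffix (_ ∷ [])     [-]     = []
    Linked-suffix (_ ∷ [])     (_ ∷ l) = l
    Linked-suffix (_ ∷ _ ∷ xs) (_ ∷ l) = Linked-suffix (_ ∷ xs) l

    crossing : ∀ {P : A → Set} → Decidable P → ∀ {x xs y} → Linked R (x ∷ xs) →
               last (x ∷ xs) ≡ just y → P x → ¬ P y → ∃₂ λ u v → P u × ¬ P v × R u v
    crossing P? {xs = []}     _       refl Px ¬Py = ⊥-elim (¬Py Px)
    crossing P? {xs = w ∷ _} (r ∷ l) ends Px ¬Py with P? w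
    ... | yes Pw = crossing P? l ends Pw ¬Py
    ... | no ¬Pw = _ , w , Px , ¬Pw , r

  Unique-resp-↭ : ∀ {xs ys : List A} → xs ↭ ys → Unique xs → Unique ys
  Unique-resp-↭ p = Permutationₛ.Unique-resp-↭ (≡.setoid A) (↭⇒↭ₛ p)

  Unique-++⁻ : ∀ xs {ys : List A} → Unique (xs ++ ys) → Unique xs × Unique ys × Disjoint xs ys
  Unique-++⁻ []       ys!          = [] , ys! , λ ()
  Unique-++⁻ (x ∷ xs) (x∉ ∷ xsys!) with Unique-++⁻ xs xsys!
  ... | xs! , ys! , xs#ys = All.++⁻ˡ xs x∉ ∷ xs! , ys! , λ where
    (here refl , v∈ys) → All.lookup (All.++⁻ʳ xs x∉) v∈ys refl
    (there v∈xs , v∈ys) → xs#ys (v∈xs , v∈ys)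

  length-≤ : ∀ {xs ys : List A} → Unique xs → (∀ {v} → v ∈ xs → v ∈ ys) → length xs ≤ length ys
  length-≤ {[]}     _         _   = z≤n
  length-≤ {x ∷ xs} (x∉ ∷ xs!) sub with ∈-∃++ (sub (here refl))
  ... | l , r , refl = subst (suc (length xs) ≤_) (sym (↭.↭-length shifted))
                             (s≤s (length-≤ xs! sub′))
    where
    shifted = ↭.shift x l r
    sub′ : ∀ {v} → v ∈ xs → v ∈ l ++ r
    sub′ v∈xs with ↭.∈-resp-↭ shifted (sub (there v∈xs))
    ... | here refl = ⊥-elim (All.lookup x∉ v∈xs refl)
    ... | there v∈  = v∈

  module _ (_≟_ : DecidableEquality A) where
    open DecMembership _≟_ using (_∈?_)

    ∃-∉ : ∀ {xs ys : List A} → Unique xs → length ys < length xs → ∃ λ x → x ∈ xs × x ∉ ys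
    ∃-∉ {xs} {ys} xs! ys<xs with any? (λ x → ¬? (x ∈? ys)) xs
    ... | yes fresh = find fresh
    ... | no ¬fresh = ⊥-elim (<-irrefl refl (<-≤-trans ys<xs (length-≤ xs! xs⊆ys)))
      where
      xs⊆ys : ∀ {v} → v ∈ xs → v ∈ ys
      xs⊆ys {v} v∈xs with v ∈? ys
      ... | yes v∈ys = v∈ys
      ... | no v∉ys  = ⊥-elim (¬fresh (lose v∈xs v∉ys))

  count≡length-filter : ∀ (f : A → Bool) xs →
                        sum (map (λ w → if f w then 1 else 0) xs) ≡ length (filter (T? ∘ f) xs)
  count≡length-filter f []       = refl
  count≡length-filter f (x ∷ xs) with f x
  ... | true  = cong suc (count≡length-filter f xs)
  ... | false = count≡length-filter f xs

  nthOr : A → List A → ℕ → A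
  nthOr d []       _       = d
  nthOr d (x ∷ xs) zero    = x
  nthOr d (x ∷ xs) (suc i) = nthOr d xs i

  nthOr-∈ : ∀ d xs {i} → i < length xs → nthOr d xs i ∈ xs
  nthOr-∈ d (x ∷ xs) {zero}  _         = here refl
  nthOr-∈ d (x ∷ xs) {suc i} (s≤s i<) = there (nthOr-∈ d xs i<)

  nthOr-linked : ∀ {R : A → A → Set} d {xs i} → Linked R xs → suc i < length xs →
                 R (nthOr d xs i) (nthOr d xs (suc i))
  nthOr-linked d {i = zero}  (r ∷ _) _          = r
  nthOr-linked d {i = zero}  [-]     (s≤s ())
  nthOr-linked d {i = suc i} (_ ∷ l) (s≤s i+1<) = nthOr-linked d l i+1<

  nthOr-injective : ∀ d {xs i j} → Unique xs → i < length xs → j < length xs →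
                    nthOr d xs i ≡ nthOr d xs j → i ≡ j
  nthOr-injective d {x ∷ xs} {zero}  {zero}  _          _        _        _ = refl
  nthOr-injective d {x ∷ xs} {zero}  {suc j} (x∉ ∷ _)   _        (s≤s j<) e =
    ⊥-elim (All.lookup x∉ (nthOr-∈ d xs j<) e)
  nthOr-injective d {x ∷ xs} {suc i} {zero}  (x∉ ∷ _)   (s≤s i<) _        e =
    ⊥-elim (All.lookup x∉ (nthOr-∈ d xs i<) (sym e))
  nthOr-injective d {x ∷ xs} {suc i} {suc j} (_ ∷ xs!)  (s≤s i<) (s≤s j<) e =
    cong suc (nthOr-injective d xs! i< j< e)

  nthOr-surjective : ∀ d {xs v} → v ∈ xs → ∃ λ i → i < length xs × nthOr d xs i ≡ v
  nthOr-surjective d (here refl) = zero , s≤s z≤n , refl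
  nthOr-surjective d (there v∈) with nthOr-surjective d v∈
  ... | i , i< , e = suc i , s≤s i< , e

module _ {A B : Set} (f : A → B) where

  Unique-map-on : ∀ {xs} → (∀ {a b} → a ∈ xs → b ∈ xs → f a ≡ f b → a ≡ b) → Unique xs → Unique (map f xs)
  Unique-map-on {[]}     _   []         = []
  Unique-map-on {x ∷ xs} inj (x∉ ∷ xs!) =
    All.map⁺ (All.tabulate λ b∈ fx≡fb → All.lookup x∉ b∈ (inj (here refl) (there b∈) fx≡fb)) ∷
    Unique-map-on (λ a∈ b∈ → inj (there a∈) (there b∈)) xs!

  lastOf-map : ∀ x xs → lastOf (f x) (map f xs) ≡ f (lastOf x xs)
  lastOf-map x []       = refl
  lastOf-map x (y ∷ ys) = lastOf-map y ys

  IsCycle-map : ∀ {R : A → A → Set} {S : B → B → Set} → (∀ {a b} → R a b → S (f a) (f b)) →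
                ∀ {xs} → (∀ {a b} → a ∈ xs → b ∈ xs → f a ≡ f b → a ≡ b) →
                IsCycle R xs → IsCycle S (map f xs)
  IsCycle-map f-hom {x ∷ xs} inj (long , x∷xs! , linked , closes)
    rewrite last≡lastOf x xs | last≡lastOf (f x) (map f xs) | lastOf-map x xs =
    subst (3 ≤_) (sym (length-map f (x ∷ xs))) long ,
    Unique-map-on inj x∷xs! ,
    Linked.map⁺ (Linked.map f-hom linked) ,
    f-hom closes

≤-foldr-⊔ : ∀ {x xs} → x ∈ xs → x ≤ foldr _⊔_ 0 xs
≤-foldr-⊔ {xs = y ∷ ys} (here refl) = m≤m⊔n y _
≤-foldr-⊔ {xs = y ∷ ys} (there x∈)  = m≤n⇒m≤o⊔n y (≤-foldr-⊔ x∈)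

twice : ℕ → ℕ
twice zero    = zero
twice (suc n) = suc (suc (twice n))

twice-mono-≤ : ∀ {s t} → s ≤ t → twice s ≤ twice t
twice-mono-≤ {zero}  _         = z≤n
twice-mono-≤ {suc s} (s≤s s≤t) = s≤s (s≤s (twice-mono-≤ s≤t))

twice-mono-< : ∀ {s t} → s < t → twice s < twice t
twice-mono-< {zero}  {suc t} _       = s≤s z≤n
twice-mono-< {suc s} {suc t} (s≤s s<t) = s≤s (s≤s (twice-mono-< s<t))

twice≡*2 : ∀ t → twice t ≡ t * 2
twice≡*2 zero    = refl
twice≡*2 (suc t) = cong (λ x → suc (suc x)) (twice≡*2 t)

<-suc-cases : ∀ {P : ℕ → Set} {h} → (∀ {t} → t < h → P t) → P h → ∀ {t} → t < suc h → P t
<-suc-cases old new t<h+1 with m<1+n⇒m<n∨m≡n t<h+1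
... | inj₁ t<h  = old t<h
... | inj₂ refl = new

module _ {A B : Set} where

  cartesianProduct-++ˡ : ∀ (xs ys : List A) (zs : List B) →
                         cartesianProduct (xs ++ ys) zs ≡ cartesianProduct xs zs ++ cartesianProduct ys zs
  cartesianProduct-++ˡ []       ys zs = refl
  cartesianProduct-++ˡ (x ∷ xs) ys zs =
    trans (cong (map (x ,_) zs ++_) (cartesianProduct-++ˡ xs ys zs)) (sym (++-assoc (map (x ,_) zs) _ _))

  cartesianProduct-++ʳ : ∀ (xs : List A) (ys zs : List B) →
                         cartesianProduct xs (ys ++ zs) ↭ cartesianProduct xs ys ++ cartesianProduct xs zs
  cartesianProduct-++ʳ []       ys zs = ↭-refl
  cartesianProduct-++ʳ (x ∷ xs) ys zs = begin
    map (x ,_) (ys ++ zs) ++ cartesianProduct xs (ys ++ zs)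
      ≡⟨ cong (_++ _) (map-++ (x ,_) ys zs) ⟩
    (map (x ,_) ys ++ map (x ,_) zs) ++ cartesianProduct xs (ys ++ zs)
      ↭⟨ ↭.++⁺ˡ (map (x ,_) ys ++ map (x ,_) zs) (cartesianProduct-++ʳ xs ys zs) ⟩
    (map (x ,_) ys ++ map (x ,_) zs) ++ cartesianProduct xs ys ++ cartesianProduct xs zs
      ≡⟨ ++-assoc (map (x ,_) ys) _ _ ⟩
    map (x ,_) ys ++ map (x ,_) zs ++ cartesianProduct xs ys ++ cartesianProduct xs zs
      ↭⟨ ↭.++⁺ˡ (map (x ,_) ys) (↭.shifts (map (x ,_) zs) (cartesianProduct xs ys)) ⟩
    map (x ,_) ys ++ cartesianProduct xs ys ++ map (x ,_) zs ++ cartesianProduct xs zs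
      ≡⟨ ++-assoc (map (x ,_) ys) _ _ ⟨
    (map (x ,_) ys ++ cartesianProduct xs ys) ++ map (x ,_) zs ++ cartesianProduct xs zs ∎
    where open PermutationReasoning

module Cycles {V : Set} (E : V → V → Set) (E-sym : ∀ {a b} → E a b → E b a) where

  Closes : List V → Set
  Closes []       = ⊥
  Closes (x ∷ xs) = E (lastOf x xs) x

  record Cycle : Set where
    field
      vertices : List V
      unique   : Unique vertices
      linked   : Linked E vertices
      long     : 3 ≤ length vertices
      closes   : Closes vertices

  open Cycle public

  record Path (s t : V) : Set where
    constructor path
    field
      rest   : List V
      linked : Linked E (s ∷ rest)
      ends   : lastOf s rest ≡ t

  spliceAt : ∀ {xs p q} → Consecutive xs p q → List V → List V
  spliceAt (this {p} {q} {r}) P = p ∷ P ++ q ∷ r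
  spliceAt (next {z} c)       P = z ∷ spliceAt c P

  splice-↭ : ∀ {xs p q} (c : Consecutive xs p q) P → spliceAt c P ↭ xs ++ P
  splice-↭ (this {p} {q} {r}) P = prep p (↭.++-comm P (q ∷ r))
  splice-↭ (next {z} c)       P = prep z (splice-↭ c P)

  splice-length : ∀ {xs p q} (c : Consecutive xs p q) P → length (spliceAt c P) ≡ length xs + length P
  splice-length {xs} c P = trans (↭.↭-length (splice-↭ c P)) (length-++ xs)

  splice-keeps : ∀ {xs p q a b} (c : Consecutive xs p q) P →
                 Consecutive xs a b → ¬ (a ≡ p × b ≡ q) → Consecutive (spliceAt c P) a b
  splice-keeps this            P this     ≢pq = ⊥-elim (≢pq (refl , refl))
  splice-keeps this            P (next d) _   = next (Consecutive-++ʳ P d)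
  splice-keeps (next this)     P this     _   = this
  splice-keeps (next (next c)) P this     _   = this
  splice-keeps (next c)        P (next d) ≢pq = next (splice-keeps c P d ≢pq)

  splice-inner : ∀ {xs p q a b} (c : Consecutive xs p q) {P} →
                 Consecutive P a b → Consecutive (spliceAt c P) a b
  splice-inner this     d = next (Consecutive-++ˡ d)
  splice-inner (next c) d = next (splice-inner c d)

  splice-enters : ∀ {xs p q} (c : Consecutive xs p q) s ps → Consecutive (spliceAt c (s ∷ ps)) p s
  splice-enters this     s ps = this
  splice-enters (next c) s ps = next (splice-enters c s ps)

  splice-leaves : ∀ {xs p q} (c : Consecutive xs p q) s ps →
                  Consecutive (spliceAt c (s ∷ ps)) (lastOf s ps) q
  splice-leaves (this {y = q} {zs = r}) s ps = next (Consecutive-across s ps q r)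
  splice-leaves (next c)               s ps = next (splice-leaves c s ps)

  splice-lastOf : ∀ {xs p q} (c : Consecutive xs p q) P z → lastOf z (spliceAt c P) ≡ lastOf z xs
  splice-lastOf (this {p} {q} {r}) P z = lastOf-++ p P q r
  splice-lastOf (next {w} c)       P z = splice-lastOf c P w

  splice-linked : ∀ {xs p q s ps} (c : Consecutive xs p q) → Linked E xs → Linked E (s ∷ ps) →
                  E p s → E (lastOf s ps) q → Linked E (spliceAt c (s ∷ ps))
  splice-linked this            (_ ∷ l) lp e₁ e₂ = e₁ ∷ Linked-join lp e₂ l
  splice-linked (next this)     (e ∷ l) lp e₁ e₂ = e ∷ splice-linked this l lp e₁ e₂
  splice-linked (next (next c)) (e ∷ l) lp e₁ e₂ = e ∷ splice-linked (next c) l lp e₁ e₂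

  splice-closes : ∀ {xs p q} (c : Consecutive xs p q) P → Closes xs → Closes (spliceAt c P)
  splice-closes (this {p} {q} {r}) P cl = subst (λ z → E z p) (sym (lastOf-++ p P q r)) cl
  splice-closes (next {w} c)       P cl = subst (λ z → E z w) (sym (splice-lastOf c P w)) cl

  splice-keeps-link : ∀ {xs p q a b} (c : Consecutive xs p q) P →
                      Link xs a b → ¬ SameEdge a b p q → Link (spliceAt c P) a b
  splice-keeps-link c P (inj₁ d) ¬pq = inj₁ (splice-keeps c P d (¬pq ∘ inj₁))
  splice-keeps-link c P (inj₂ d) ¬pq = inj₂ (splice-keeps c P d (λ (b≡p , a≡q) → ¬pq (inj₂ (a≡q , b≡p))))

  splice : (H : Cycle) {p q s t : V} → Consecutive (vertices H) p q → (P : Path s t) →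
           E p s → E t q → Unique (vertices H ++ s ∷ Path.rest P) → Cycle
  splice H {s = s} c P e₁ e₂ H++P! = record
    { vertices = spliceAt c (s ∷ rest)
    ; unique   = Unique-resp-↭ (↭-sym (splice-↭ c _)) H++P!
    ; linked   = splice-linked c (linked H) (Path.linked P) e₁ (subst (λ z → E z _) (sym ends) e₂)
    ; long     = ≤-trans (long H) (≤-trans (m≤m+n _ _) (≤-reflexive (sym (splice-length c _))))
    ; closes   = splice-closes c _ (closes H)
    }
    where open Path P using (rest; ends)

  rotation-↭ : ∀ l (u v : V) r → v ∷ r ++ l ++ [ u ] ↭ l ++ u ∷ v ∷ r
  rotation-↭ l u v r = begin
    (v ∷ r) ++ l ++ [ u ]  ↭⟨ ↭.++-comm (v ∷ r) (l ++ [ u ]) ⟩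
    (l ++ [ u ]) ++ v ∷ r  ≡⟨ ++-assoc l [ u ] (v ∷ r) ⟩
    l ++ u ∷ v ∷ r         ∎
    where open PermutationReasoning

  rotation-linked : ∀ l {u v r} → Linked E (l ++ u ∷ v ∷ r) → Closes (l ++ u ∷ v ∷ r) →
                    Linked E (v ∷ r ++ l ++ [ u ])
  rotation-linked []              (_ ∷ lk) cl = Linked-join lk cl [-]
  rotation-linked (w ∷ l) {u} {v} {r} lk cl =
    Linked-join (Linked-suffix (w ∷ l ++ [ u ]) lk′)
                (subst (λ z → E z w) (lastOf-++ w l u (v ∷ r)) cl)
                (Linked-prefix (w ∷ l ++ [ u ]) lk′)
    where
    lk′ : Linked E ((w ∷ l ++ [ u ]) ++ v ∷ r)
    lk′ = subst (Linked E) (sym (++-assoc (w ∷ l) [ u ] (v ∷ r))) lk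

  rotation-ends : ∀ l (u v : V) r → lastOf v (r ++ l ++ [ u ]) ≡ u
  rotation-ends l u v r = trans (cong (lastOf v) (sym (++-assoc r l [ u ]))) (lastOf-++ v (r ++ l) u [])

  rotation-keeps : ∀ (l : List V) {u v r a b} → Consecutive (l ++ u ∷ v ∷ r) a b → a ≢ u →
                   Consecutive (v ∷ r ++ l ++ [ u ]) a b
  rotation-keeps l {v = v} {r} c a≢u =
    Sum.[ Consecutive-++ʳ (v ∷ r) , Consecutive-++ˡ ]′ (Consecutive-cut l c a≢u)

  record Opening (xs : List V) (s t : V) : Set where
    field
      walk  : Path s t
      ↭xs   : s ∷ Path.rest walk ↭ xs
      keeps : ∀ {a b} → Link xs a b → ¬ SameEdge a b s t → Link (s ∷ Path.rest walk) a b

  rotate : ∀ {xs u v} → Unique xs → Linked E xs → Closes xs → Consecutive xs u v → Opening xs v u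
  rotate {u = u} {v} xs! lk cl c with Consecutive-split c
  ... | l , r , refl = record
    { walk  = path (r ++ l ++ [ u ]) (rotation-linked l lk cl) (rotation-ends l u v r)
    ; ↭xs   = rotation-↭ l u v r
    ; keeps = λ where
        (inj₁ d) ¬vu → inj₁ (rotation-keeps l {u} {v} {r} d λ { refl → ¬vu (inj₂ (refl , after-u d)) })
        (inj₂ d) ¬vu → inj₂ (rotation-keeps l {u} {v} {r} d λ { refl → ¬vu (inj₁ (after-u d , refl)) })
    }
    where
    after-u : ∀ {w} → Consecutive (l ++ u ∷ v ∷ r) u w → w ≡ v
    after-u d = Consecutive-functional xs! d c

  reverse-walk : ∀ s ps → Linked E (s ∷ ps) →
                 Σ (List V) λ rs → reverse (s ∷ ps) ≡ lastOf s ps ∷ rs ×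
                                   Linked E (lastOf s ps ∷ rs) × lastOf (lastOf s ps) rs ≡ s
  reverse-walk s []       [-]     = [] , refl , [-] , refl
  reverse-walk s (p ∷ ps) (e ∷ l) with reverse-walk p ps l
  ... | rs , eq , l′ , ends =
    rs ++ [ s ] ,
    trans (unfold-reverse s (p ∷ ps)) (cong (_++ [ s ]) eq) ,
    Linked-join l′ (subst (λ z → E z s) (sym ends) (E-sym e)) [-] ,
    lastOf-++ _ rs s []

  Opening-reverse : ∀ {xs s t} → Opening xs s t → Opening xs t s
  Opening-reverse {xs} {s} record { walk = path ps lk refl ; ↭xs = ↭xs ; keeps = keeps }
    with reverse-walk s ps lk
  ... | rs , eq , lk′ , ends = record
    { walk  = path rs lk′ ends
    ; ↭xs   = ↭-trans (subst (_↭ s ∷ ps) eq (↭.↭-reverse (s ∷ ps))) ↭xs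
    ; keeps = λ l ¬ts → Sum.swap (Sum.map reversed reversed (keeps l (¬ts ∘ SameEdge-flip)))
    }
    where
    reversed : ∀ {a b} → Consecutive (s ∷ ps) a b → Consecutive (lastOf s ps ∷ rs) b a
    reversed d = subst (λ z → Consecutive z _ _) eq (Consecutive-reverse d)

  open-at : ∀ {xs s t} → Unique xs → Linked E xs → Closes xs → Link xs s t → Opening xs s t
  open-at xs! lk cl (inj₁ c) = Opening-reverse (rotate xs! lk cl c)
  open-at xs! lk cl (inj₂ c) = rotate xs! lk cl c

  record Joined (H K : Cycle) (p q s t : V) : Set where
    field
      cycle  : Cycle
      ↭H++K  : vertices cycle ↭ vertices H ++ vertices K
      keepsH : ∀ {a b} → Link (vertices H) a b → ¬ SameEdge a b p q → Link (vertices cycle) a b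
      keepsK : ∀ {a b} → Link (vertices K) a b → ¬ SameEdge a b s t → Link (vertices cycle) a b

  Joined-flip : ∀ {H K p q s t} → Joined H K q p t s → Joined H K p q s t
  Joined-flip J = record
    { cycle  = cycle
    ; ↭H++K  = ↭H++K
    ; keepsH = λ l ¬pq → keepsH l (¬pq ∘ SameEdge-flip)
    ; keepsK = λ l ¬st → keepsK l (¬st ∘ SameEdge-flip)
    }
    where open Joined J

  join-along : (H K : Cycle) {p q s t : V} → Consecutive (vertices H) p q → Link (vertices K) s t →
               E p s → E q t → Unique (vertices H ++ vertices K) → Joined H K p q s t
  join-along H K c l e₁ e₂ H++K! = record
    { cycle  = splice H c walk e₁ (E-sym e₂) H++P!
    ; ↭H++K  = ↭-trans (splice-↭ c _) (↭.++⁺ˡ (vertices H) ↭xs)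
    ; keepsH = splice-keeps-link c _
    ; keepsK = λ l′ ¬st → Sum.map (splice-inner c) (splice-inner c) (keeps l′ ¬st)
    }
    where
    open Opening (open-at (unique K) (linked K) (closes K) l)
    H++P! = Unique-resp-↭ (↭.++⁺ˡ (vertices H) (↭-sym ↭xs)) H++K!

  join : (H K : Cycle) {p q s t : V} → Link (vertices H) p q → Link (vertices K) s t →
         E p s → E q t → Unique (vertices H ++ vertices K) → Joined H K p q s t
  join H K (inj₁ c) l e₁ e₂ H++K! = join-along H K c l e₁ e₂ H++K!
  join H K (inj₂ c) l e₁ e₂ H++K! = Joined-flip (join-along H K c (Sum.swap l) e₂ e₁ H++K!)

  isCycle : (C : Cycle) → IsCycle E (vertices C)
  isCycle record { vertices = [] ; closes = () }
  isCycle record { vertices = x ∷ xs ; unique = x∷xs! ; linked = linked ; long = long ; closes = closes }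
    rewrite last≡lastOf x xs = long , x∷xs! , linked , closes

module Grid {U : Set} (E : U → U → Set) (E-sym : ∀ {u w} → E u w → E w u) (m : ℕ) where

  Cell : Set
  Cell = ℕ × U

  data _~_ : Cell → Cell → Set where
    across : ∀ {i u w} → E u w → (i , u) ~ (i , w)
    down   : ∀ {i u} → suc i < m → (i , u) ~ (suc i , u)
    up     : ∀ {i u} → suc i < m → (suc i , u) ~ (i , u)

  ~-sym : ∀ {x y} → x ~ y → y ~ x
  ~-sym (across e) = across (E-sym e)
  ~-sym (down i<m) = up i<m
  ~-sym (up i<m)   = down i<m

  open Cycles _~_ ~-sym public

  cells : ℕ → List U → List Cell
  cells k us = cartesianProduct (upTo k) us

  rowPair : ℕ → List U → List Cell
  rowPair i us = map (i ,_) us ++ map (suc i ,_) us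

  cells-suc : ∀ k us → cells (suc k) us ≡ cells k us ++ map (k ,_) us
  cells-suc k us = begin
    cartesianProduct (upTo (suc k)) us
      ≡⟨ cong (λ is → cartesianProduct is us) (applyUpTo-∷ʳ id k) ⟨
    cartesianProduct (upTo k ++ [ k ]) us
      ≡⟨ cartesianProduct-++ˡ (upTo k) [ k ] us ⟩
    cells k us ++ map (k ,_) us ++ []
      ≡⟨ cong (cells k us ++_) (++-identityʳ (map (k ,_) us)) ⟩
    cells k us ++ map (k ,_) us ∎
    where open ≡-Reasoning

  cells-suc-suc : ∀ i us → cells (suc (suc i)) us ≡ cells i us ++ rowPair i us
  cells-suc-suc i us =
    trans (cells-suc (suc i) us)
      (trans (cong (_++ map (suc i ,_) us) (cells-suc i us)) (++-assoc (cells i us) _ _))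

  cells-++ : ∀ k us ws → cells k (us ++ ws) ↭ cells k us ++ cells k ws
  cells-++ k = cartesianProduct-++ʳ (upTo k)

  cells-unique : ∀ k {us} → Unique us → Unique (cells k us)
  cells-unique k us! = Unique.cartesianProduct⁺ (Unique.upTo⁺ k) us!

  ∈-cells⁺ : ∀ {k us i u} → i < k → u ∈ us → (i , u) ∈ cells k us
  ∈-cells⁺ i<k u∈us = ∈-cartesianProduct⁺ (∈-upTo⁺ i<k) u∈us

  ∈-cells⁻ : ∀ {k us i u} → (i , u) ∈ cells k us → i < k × u ∈ us
  ∈-cells⁻ {k} {us} w∈ with ∈-cartesianProduct⁻ (upTo k) us w∈
  ... | i∈ , u∈ = ∈-upTo⁻ i∈ , u∈

  record HamiltonianGrid : Set where
    field
      cycle    : Cycle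
      rows<    : ∀ {w} → w ∈ vertices cycle → proj₁ w < m
      complete : ∀ {i} u → i < m → (i , u) ∈ vertices cycle

  Vertical : Cycle → ℕ → U → Set
  Vertical C i u = Link (vertices C) (i , u) (suc i , u)

  vertical-not-rung : ∀ {j u i v w} → ¬ SameEdge {A = Cell} (j , u) (suc j , u) (i , v) (i , w)
  vertical-not-rung (inj₁ (refl , ()))
  vertical-not-rung (inj₂ (refl , ()))

  vertical-same : ∀ {j u i x} → SameEdge {A = Cell} (j , u) (suc j , u) (i , x) (suc i , x) → j ≡ i × u ≡ x
  vertical-same (inj₁ (refl , refl)) = refl , refl
  vertical-same (inj₂ (refl , ()))

  module TwoColumns {a b : U} (ab : E a b) (a≢b : a ≢ b) where

    pair : List U
    pair = a ∷ b ∷ []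

    pair! : Unique pair
    pair! = (a≢b ∷ []) ∷ [] ∷ []

    record Ladder (r : ℕ) : Set where
      field
        cycle     : Cycle
        ↭cells    : vertices cycle ↭ cells (suc r) pair
        verticals : ∀ {j} → j < r → Vertical cycle j a × Vertical cycle j b
        top       : Consecutive (vertices cycle) (r , a) (r , b)

    square : 1 < m → Ladder 1
    square 1<m = record
      { cycle     = record
          { vertices = (0 , a) ∷ (1 , a) ∷ (1 , b) ∷ (0 , b) ∷ []
          ; unique   = Unique-resp-↭ (↭-sym ↭square) (cells-unique 2 pair!)
          ; linked   = down 1<m ∷ across ab ∷ up 1<m ∷ [-]
          ; long     = s≤s (s≤s (s≤s z≤n))
          ; closes   = across (E-sym ab)
          }
      ; ↭cells    = ↭square
      ; verticals = λ { {zero} _ → inj₁ this , inj₂ (next (next this)) ; {suc _} (s≤s ()) }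
      ; top       = next this
      }
      where
      ↭square : (0 , a) ∷ (1 , a) ∷ (1 , b) ∷ (0 , b) ∷ [] ↭ cells 2 pair
      ↭square = prep (0 , a) (↭.shift (0 , b) ((1 , a) ∷ (1 , b) ∷ []) [])

    grow : ∀ {r} → suc r < m → Ladder r → Ladder (suc r)
    grow {r} r+1<m L = record
      { cycle     = M
      ; ↭cells    = ↭-trans (splice-↭ top rung) grown
      ; verticals = <-suc-cases (λ j<r → Product.map keep keep (verticals j<r))
                                (inj₁ (splice-enters top _ _) , inj₂ (splice-leaves top _ _))
      ; top       = splice-inner top this
      }
      where
      open Ladder L
      rung : List Cell
      rung = (suc r , a) ∷ (suc r , b) ∷ []
      grown : vertices cycle ++ rung ↭ cells (suc (suc r)) pair
      grown = subst (vertices cycle ++ rung ↭_) (sym (cells-suc (suc r) pair)) (↭.++⁺ʳ rung ↭cells)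
      M : Cycle
      M = splice cycle top (path [ (suc r , b) ] (across ab ∷ [-]) refl) (down r+1<m) (up r+1<m)
                 (Unique-resp-↭ (↭-sym grown) (cells-unique (suc (suc r)) pair!))
      keep : ∀ {j u} → Vertical cycle j u → Vertical M j u
      keep v = splice-keeps-link top rung v vertical-not-rung

    ladder : ∀ r → 1 ≤ r → r < m → Ladder r
    ladder (suc zero)    _ 1<m   = square 1<m
    ladder (suc (suc r)) _ r+2<m = grow r+2<m (ladder (suc r) (s≤s z≤n) (<-trans (n<1+n (suc r)) r+2<m))

  module ThreeColumns {a b c : U} (ab : E a b) (bc : E b c) (a≢b : a ≢ b) (b≢c : b ≢ c) (a≢c : a ≢ c)
                      (D : ℕ) where

    triple : List U
    triple = a ∷ b ∷ c ∷ []

    triple! : Unique triple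
    triple! = (a≢b ∷ a≢c ∷ []) ∷ (b≢c ∷ []) ∷ [] ∷ []

    record Braid (h : ℕ) : Set where
      field
        cycle  : Cycle
        ↭cells : vertices cycle ↭ cells (twice (suc h)) triple
        even-a : ∀ {t} → t < suc h → Vertical cycle (twice t) a
        even-c : ∀ {t} → t < suc h → Vertical cycle (twice t) c
        odd-b  : ∀ {t} → t < h → Vertical cycle (suc (twice t)) b
        odd-a  : ∀ {t} → t < h → t < D → Vertical cycle (suc (twice t)) a
        odd-c  : ∀ {t} → t < h → D ≤ t → Vertical cycle (suc (twice t)) c
        top-ab : Consecutive (vertices cycle) (suc (twice h) , a) (suc (twice h) , b)
        top-bc : Consecutive (vertices cycle) (suc (twice h) , b) (suc (twice h) , c)

    uTurnAB uTurnBC : ℕ → List Cell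
    uTurnAB i = (i , a) ∷ (suc i , a) ∷ (suc i , b) ∷ (suc i , c) ∷ (i , c) ∷ (i , b) ∷ []
    uTurnBC i = (i , b) ∷ (i , a) ∷ (suc i , a) ∷ (suc i , b) ∷ (suc i , c) ∷ (i , c) ∷ []

    uTurnAB-↭ : ∀ i → uTurnAB i ↭ rowPair i triple
    uTurnAB-↭ i = prep (i , a) (↭-trans (↭.++-comm (map (suc i ,_) triple) ((i , c) ∷ (i , b) ∷ []))
                                        (swap (i , c) (i , b) ↭-refl))

    uTurnBC-↭ : ∀ i → uTurnBC i ↭ rowPair i triple
    uTurnBC-↭ i = swap (i , b) (i , a) (↭.++-comm (map (suc i ,_) triple) [ (i , c) ])

    base : 1 < m → Braid 0
    base 1<m = record
      { cycle  = record
          { vertices = uTurnAB 0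
          ; unique   = Unique-resp-↭ (↭-sym (uTurnAB-↭ 0)) (cells-unique 2 triple!)
          ; linked   = down 1<m ∷ across ab ∷ across bc ∷ up 1<m ∷ across (E-sym bc) ∷ [-]
          ; long     = s≤s (s≤s (s≤s z≤n))
          ; closes   = across (E-sym ab)
          }
      ; ↭cells = uTurnAB-↭ 0
      ; even-a = λ { (s≤s z≤n) → inj₁ this }
      ; even-c = λ { (s≤s z≤n) → inj₂ (next (next (next this))) }
      ; odd-b  = λ ()
      ; odd-a  = λ ()
      ; odd-c  = λ ()
      ; top-ab = next this
      ; top-bc = next (next this)
      }

    module Grow {h} (room : suc (twice (suc h)) < m) (B : Braid h) where
      open Braid B

      R : ℕ
      R = twice (suc h)

      grown : ∀ {P : List Cell} → P ↭ rowPair R triple →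
              vertices cycle ++ P ↭ cells (twice (suc (suc h))) triple
      grown {P} P↭ = subst (vertices cycle ++ P ↭_) (sym (cells-suc-suc R triple)) (↭.++⁺ ↭cells P↭)

      extend : (M : Cycle) → vertices M ↭ cells (twice (suc (suc h))) triple →
               (∀ {j u} → Vertical cycle j u → Vertical M j u) →
               Vertical M R a → Vertical M R c → Vertical M (suc (twice h)) b →
               (h < D → Vertical M (suc (twice h)) a) → (D ≤ h → Vertical M (suc (twice h)) c) →
               Consecutive (vertices M) (suc R , a) (suc R , b) →
               Consecutive (vertices M) (suc R , b) (suc R , c) → Braid (suc h)
      extend M ↭M keep ea ec ob oa oc tab tbc = record
        { cycle  = M
        ; ↭cells = ↭M
        ; even-a = <-suc-cases (keep ∘ even-a) ea
        ; even-c = <-suc-cases (keep ∘ even-c) ec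
        ; odd-b  = <-suc-cases (keep ∘ odd-b) ob
        ; odd-a  = <-suc-cases (λ t<h → keep ∘ odd-a t<h) oa
        ; odd-c  = <-suc-cases (λ t<h → keep ∘ odd-c t<h) oc
        ; top-ab = tab
        ; top-bc = tbc
        }

      R<m : R < m
      R<m = <-trans (n<1+n R) room

      -- Below row 2D the new U-turn hangs on the top a–b rung and from then on on the b–c rung,
      -- which is why column a goes vertically in the low odd rows and column c in the high ones.
      low : h < D → Braid (suc h)
      low h<D = extend M (↭-trans (splice-↭ top-ab _) (grown (uTurnAB-↭ R)))
        (λ v → splice-keeps-link top-ab _ v vertical-not-rung)
        (inj₁ (splice-inner top-ab this)) (inj₂ (splice-inner top-ab (next (next (next this)))))
        (inj₂ (splice-leaves top-ab _ _)) (λ _ → inj₁ (splice-enters top-ab _ _))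
        (λ D≤h → ⊥-elim (<-irrefl refl (<-≤-trans h<D D≤h)))
        (splice-inner top-ab (next this)) (splice-inner top-ab (next (next this)))
        where
        M = splice cycle top-ab
              (path _ (down room ∷ across ab ∷ across bc ∷ up room ∷ across (E-sym bc) ∷ [-]) refl)
              (down R<m) (up R<m)
              (Unique-resp-↭ (↭-sym (grown (uTurnAB-↭ R))) (cells-unique (twice (suc (suc h))) triple!))

      high : D ≤ h → Braid (suc h)
      high D≤h = extend M (↭-trans (splice-↭ top-bc _) (grown (uTurnBC-↭ R)))
        (λ v → splice-keeps-link top-bc _ v vertical-not-rung)
        (inj₁ (splice-inner top-bc (next this)))
        (inj₂ (splice-inner top-bc (next (next (next (next this))))))
        (inj₁ (splice-enters top-bc _ _))
        (λ h<D → ⊥-elim (<-irrefl refl (<-≤-trans h<D D≤h)))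
        (λ _ → inj₂ (splice-leaves top-bc _ _))
        (splice-inner top-bc (next (next this))) (splice-inner top-bc (next (next (next this))))
        where
        M = splice cycle top-bc
              (path _ (across (E-sym ab) ∷ down room ∷ across ab ∷ across bc ∷ up room ∷ [-]) refl)
              (down R<m) (up R<m)
              (Unique-resp-↭ (↭-sym (grown (uTurnBC-↭ R))) (cells-unique (twice (suc (suc h))) triple!))

    braid : ∀ h → suc (twice h) < m → Braid h
    braid zero    1<m  = base 1<m
    braid (suc h) room with braid h (<-trans (n<1+n _) (<-trans (n<1+n _) room)) | h <? D
    ... | B | yes h<D = Grow.low room B h<D
    ... | B | no h≮D  = Grow.high room B (≮⇒≥ h≮D)

module Merging {U : Set} (_≟_ : DecidableEquality U) (E : U → U → Set) (E-sym : ∀ {u w} → E u w → E w u)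
  (connected : ∀ u v → ∃ λ p → Linked E (u ∷ p) × last (u ∷ p) ≡ just v)
  (Δ : ℕ) (degree-bound : ∀ {x ws} → Unique ws → All (E x) ws → length ws ≤ Δ)
  (m : ℕ) (Role : Set) (Offers : Role → ℕ → Set) (shared : Role → Role → List ℕ)
  (shared-offered : ∀ r r′ {i} → i ∈ shared r r′ → Offers r i × Offers r′ i)
  (shared-unique : ∀ r r′ → Unique (shared r r′))
  (shared-enough : ∀ r r′ → Δ ≤ suc (length (shared r r′)))
  where

  open Grid E E-sym m
  open DecMembership _≟_ using (_∈?_)

  -- The contacts of u are its partner in its own block and the vertices it has been joined to,
  -- one join per used row.
  record Ports (merged : List U) (C : Cycle) (u : U) : Set where
    field
      role              : Role
      contacts          : List U
      used              : List ℕ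
      contacts-unique   : Unique contacts
      contacts-adjacent : All (E u) contacts
      contacts-merged   : All (_∈ merged) contacts
      used<contacts     : length used < length contacts
      free              : ∀ {i} → Offers role i → i ∉ used → Vertical C i u

  ∉-contacts : ∀ {ins C u z} (P : Ports ins C u) → z ∉ ins → All (z ≢_) (Ports.contacts P)
  ∉-contacts P z∉ = All.map (λ w∈ z≡w → z∉ (subst (_∈ _) (sym z≡w) w∈)) (Ports.contacts-merged P)

  Ports-weaken : ∀ {ins ins′ C C′ u} → Ports ins C u → (∀ {w} → w ∈ ins → w ∈ ins′) →
                 (∀ {j} → Vertical C j u → Vertical C′ j u) → Ports ins′ C′ u
  Ports-weaken P ins⊆ keep = record
    { Ports P
    ; contacts-merged = All.map ins⊆ (Ports.contacts-merged P)
    ; free            = λ o j∉ → keep (Ports.free P o j∉)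
    }

  Ports-extend : ∀ {ins ins′ C C′ u z} (P : Ports ins C u) → z ∉ ins → E u z → z ∈ ins′ →
                 (∀ {w} → w ∈ ins → w ∈ ins′) → ∀ i →
                 (∀ {j} → j ≢ i → Vertical C j u → Vertical C′ j u) → Ports ins′ C′ u
  Ports-extend {z = z} P z∉ e z∈ ins⊆ i keep = record
    { role              = role
    ; contacts          = z ∷ contacts
    ; used              = i ∷ used
    ; contacts-unique   = ∉-contacts P z∉ ∷ contacts-unique
    ; contacts-adjacent = e ∷ contacts-adjacent
    ; contacts-merged   = z∈ ∷ All.map ins⊆ contacts-merged
    ; used<contacts     = s≤s used<contacts
    ; free              = λ o j∉ → keep (λ j≡i → j∉ (here j≡i)) (free o (λ j∈ → j∉ (there j∈)))
    }
    where open Ports P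

  free-row : ∀ {ins C x y} (P : Ports ins C x) → y ∉ ins → E x y → ∀ r →
             ∃ λ i → i ∈ shared (Ports.role P) r × i ∉ Ports.used P
  free-row {y = y} P y∉ exy r = ∃-∉ ℕ._≟_ (shared-unique role r) used<shared
    where
    open Ports P
    -- y is a further neighbour of x, so |used| < |contacts| ≤ Δ - 1 ≤ |shared|.
    y∷contacts! : Unique (y ∷ contacts)
    y∷contacts! = ∉-contacts P y∉ ∷ contacts-unique
    used<shared : length used < length (shared role r)
    used<shared = ≤-trans used<contacts
      (≤-pred (≤-trans (degree-bound y∷contacts! (exy ∷ contacts-adjacent)) (shared-enough role r)))

  record Block : Set where
    field
      columns : List U
      anchor  : U
      anchor∈ : anchor ∈ columns
      cycle   : Cycle
      ↭cells  : vertices cycle ↭ cells m columns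
      role    : ∀ {u} → u ∈ columns → Role
      partner : ∀ {u} → u ∈ columns → ∃ λ w → w ∈ columns × E u w
      offered : ∀ {u} (u∈ : u ∈ columns) {i} → Offers (role u∈) i → Vertical cycle i u

    ports : ∀ {u} → u ∈ columns → Ports columns cycle u
    ports u∈ with partner u∈
    ... | w , w∈ , uw = record
      { role              = role u∈
      ; contacts          = [ w ]
      ; used              = []
      ; contacts-unique   = [] ∷ []
      ; contacts-adjacent = uw ∷ []
      ; contacts-merged   = w∈ ∷ []
      ; used<contacts     = s≤s z≤n
      ; free              = λ o _ → offered u∈ o
      }

  columnsOf : List Block → List U
  columnsOf = concatMap Block.columns

  ∈-columnsOf : ∀ {y} Bs → y ∈ columnsOf Bs →
                ∃ λ B → ∃₂ λ R₁ R₂ → Bs ≡ R₁ ++ B ∷ R₂ × y ∈ Block.columns B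
  ∈-columnsOf Bs y∈ with find (∈-concatMap⁻ Block.columns {xs = Bs} y∈)
  ... | B , B∈ , y∈B with ∈-∃++ B∈
  ...   | R₁ , R₂ , eq = B , R₁ , R₂ , eq , y∈B

  record State (k : ℕ) : Set where
    field
      merged   : List U
      pending  : List Block
      size     : length pending ≡ k
      distinct : Unique (merged ++ columnsOf pending)
      covers   : ∀ u → u ∈ merged ++ columnsOf pending
      cycle    : Cycle
      ↭cells   : vertices cycle ↭ cells m merged
      root     : U
      root∈    : root ∈ merged
      ports    : ∀ {u} → u ∈ merged → Ports merged cycle u

  module Absorb {k} (S : State (suc k)) {x y : U} {B : Block} {R₁ R₂ : List Block}
                (x∈ : x ∈ State.merged S) (y∉ : y ∉ State.merged S) (xy : E x y)
                (split : State.pending S ≡ R₁ ++ B ∷ R₂) (y∈B : y ∈ Block.columns B) where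

    open State S
    module B = Block B

    merged′ : List U
    merged′ = B.columns ++ merged

    regroup : merged ++ columnsOf pending ↭ merged′ ++ columnsOf (R₁ ++ R₂)
    regroup = begin
      merged ++ columnsOf pending
        ≡⟨ cong (λ Bs → merged ++ columnsOf Bs) split ⟩
      merged ++ columnsOf (R₁ ++ B ∷ R₂)
        ≡⟨ cong (merged ++_) (concatMap-++ Block.columns R₁ (B ∷ R₂)) ⟩
      merged ++ columnsOf R₁ ++ B.columns ++ columnsOf R₂
        ↭⟨ ↭.++⁺ˡ merged (↭.shifts (columnsOf R₁) B.columns) ⟩
      merged ++ B.columns ++ columnsOf R₁ ++ columnsOf R₂
        ↭⟨ ↭.shifts merged B.columns ⟩
      B.columns ++ merged ++ columnsOf R₁ ++ columnsOf R₂
        ≡⟨ ++-assoc B.columns merged _ ⟨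
      merged′ ++ columnsOf R₁ ++ columnsOf R₂
        ≡⟨ cong (merged′ ++_) (concatMap-++ Block.columns R₁ R₂) ⟨
      merged′ ++ columnsOf (R₁ ++ R₂) ∎
      where open PermutationReasoning

    unique′ : Unique (merged′ ++ columnsOf (R₁ ++ R₂))
    unique′ = Unique-resp-↭ regroup distinct

    merged′! : Unique merged′
    merged′! = proj₁ (Unique-++⁻ merged′ unique′)

    merged#block : ∀ {w} → w ∈ merged → w ∉ B.columns
    merged#block w∈ w∈B = proj₂ (proj₂ (Unique-++⁻ B.columns merged′!)) (w∈B , w∈)

    module X = Ports (ports x∈)

    ry : Role
    ry = B.role y∈B

    row : ∃ λ i → i ∈ shared X.role ry × i ∉ X.used
    row = free-row (ports x∈) y∉ xy ry

    i : ℕ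
    i = proj₁ row

    cells-merged′ : vertices cycle ++ vertices B.cycle ↭ cells m merged′
    cells-merged′ = begin
      vertices cycle ++ vertices B.cycle    ↭⟨ ↭.++-comm (vertices cycle) _ ⟩
      vertices B.cycle ++ vertices cycle    ↭⟨ ↭.++⁺ B.↭cells ↭cells ⟩
      cells m B.columns ++ cells m merged   ↭⟨ cells-++ m B.columns merged ⟨
      cells m merged′                       ∎
      where open PermutationReasoning

    J : Joined cycle B.cycle (i , x) (suc i , x) (i , y) (suc i , y)
    J = join cycle B.cycle
          (X.free (proj₁ (shared-offered X.role ry (proj₁ (proj₂ row)))) (proj₂ (proj₂ row)))
          (B.offered y∈B (proj₂ (shared-offered X.role ry (proj₁ (proj₂ row)))))
          (across xy) (across xy)
          (Unique-resp-↭ (↭-sym cells-merged′) (cells-unique m merged′!))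

    M : Cycle
    M = Joined.cycle J

    keepH : ∀ {j u} → ¬ (j ≡ i × u ≡ x) → Vertical cycle j u → Vertical M j u
    keepH ≢ix v = Joined.keepsH J v (λ same → ≢ix (vertical-same same))

    keepK : ∀ {j u} → ¬ (j ≡ i × u ≡ y) → Vertical B.cycle j u → Vertical M j u
    keepK ≢iy v = Joined.keepsK J v (λ same → ≢iy (vertical-same same))

    merged⊆ : ∀ {w} → w ∈ merged → w ∈ merged′
    merged⊆ = ∈-++⁺ʳ B.columns

    ports′ : ∀ {u} → u ∈ merged′ → Ports merged′ M u
    ports′ {u} u∈ with u ≟ x | u ≟ y | ∈-++⁻ B.columns u∈
    ... | yes refl | _        | _         =
      Ports-extend (ports x∈) y∉ xy (∈-++⁺ˡ y∈B) merged⊆ i (λ j≢i → keepH (λ (j≡i , _) → j≢i j≡i))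
    ... | no _     | yes refl | _         =
      Ports-extend (B.ports y∈B) (merged#block x∈) (E-sym xy) (merged⊆ x∈) ∈-++⁺ˡ i
                   (λ j≢i → keepK (λ (j≡i , _) → j≢i j≡i))
    ... | no _     | no u≢y   | inj₁ u∈B  =
      Ports-weaken (B.ports u∈B) ∈-++⁺ˡ (keepK (λ (_ , u≡y) → u≢y u≡y))
    ... | no u≢x   | no _     | inj₂ u∈H  =
      Ports-weaken (ports u∈H) merged⊆ (keepH (λ (_ , u≡x) → u≢x u≡x))

    next-state : State k
    next-state = record
      { merged   = merged′
      ; pending  = R₁ ++ R₂
      ; size     = suc-injective (trans (sym (↭.↭-length (↭.shift B R₁ R₂)))
                                        (trans (cong length (sym split)) size))
      ; distinct = unique′
      ; covers   = λ u → ↭.∈-resp-↭ regroup (covers u)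
      ; cycle    = M
      ; ↭cells   = ↭-trans (Joined.↭H++K J) cells-merged′
      ; root     = root
      ; root∈    = merged⊆ root∈
      ; ports    = ports′
      }

  module _ {k} (S : State (suc k)) where
    open State S

    pending-column : ∃ λ v → v ∈ columnsOf pending
    pending-column with pending | size
    ... | B ∷ _ | _ = Block.anchor B , ∈-++⁺ˡ (Block.anchor∈ B)

    outside : ∀ {v} → v ∈ columnsOf pending → v ∉ merged
    outside v∈ v∈merged = proj₂ (proj₂ (Unique-++⁻ merged distinct)) (v∈merged , v∈)

    pending-of : ∀ {y} → y ∉ merged → y ∈ columnsOf pending
    pending-of {y} y∉ with ∈-++⁻ merged (covers y)
    ... | inj₁ y∈ = ⊥-elim (y∉ y∈)
    ... | inj₂ y∈ = y∈

    absorb : State k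
    absorb with pending-column
    ... | v , v∈ with connected root v
    ...   | _ , walk , ends with crossing (_∈? merged) walk ends root∈ (outside v∈)
    ...     | x , y , x∈ , y∉ , xy with ∈-columnsOf pending (pending-of y∉)
    ...       | B , R₁ , R₂ , split , y∈B = Absorb.next-state S x∈ y∉ xy split y∈B

  merge-all : ∀ k → State k → HamiltonianGrid
  merge-all (suc k) S = merge-all k (absorb S)
  merge-all zero    S = record
    { cycle    = cycle
    ; rows<    = λ { {_ , _} w∈ → proj₁ (∈-cells⁻ (↭.∈-resp-↭ ↭cells w∈)) }
    ; complete = λ u i<m → ↭.∈-resp-↭ (↭-sym ↭cells) (∈-cells⁺ i<m (all-merged u))
    }
    where
    open State S
    all-merged : ∀ u → u ∈ merged
    all-merged u with pending | size | ∈-++⁻ merged (covers u)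
    ... | _  | _ | inj₁ u∈ = u∈
    ... | [] | _ | inj₂ ()

  -- The vertex only rules out an empty list of blocks.
  hamiltonian-grid : U → (Bs : List Block) → Unique (columnsOf Bs) → (∀ u → u ∈ columnsOf Bs) →
                     HamiltonianGrid
  hamiltonian-grid u₀ []       _        covers with covers u₀
  ... | ()
  hamiltonian-grid _  (B ∷ Bs) distinct covers = merge-all (length Bs) (record
    { merged   = Block.columns B
    ; pending  = Bs
    ; size     = refl
    ; distinct = distinct
    ; covers   = covers
    ; cycle    = Block.cycle B
    ; ↭cells   = Block.↭cells B
    ; root     = Block.anchor B
    ; root∈    = Block.anchor∈ B
    ; ports    = Block.ports B
    })

  ladder-block : ∀ {a b} → E a b → a ≢ b → ∀ r → m ≡ suc r → 1 ≤ r →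
                 (role : Role) → (∀ {i} → Offers role i → i < r) → Block
  ladder-block {a} {b} ab a≢b r m≡ 1≤r role offered<r = record
    { columns = pair
    ; anchor  = a
    ; anchor∈ = here refl
    ; cycle   = cycle
    ; ↭cells  = subst (λ k → vertices cycle ↭ cells k pair) (sym m≡) ↭cells
    ; role    = λ _ → role
    ; partner = λ where
        (here refl)         → b , there (here refl) , ab
        (there (here refl)) → a , here refl , E-sym ab
    ; offered = λ where
        (here refl)         o → proj₁ (verticals (offered<r o))
        (there (here refl)) o → proj₂ (verticals (offered<r o))
    }
    where
    open TwoColumns ab a≢b
    open Ladder (ladder r 1≤r (subst (r <_) (sym m≡) (n<1+n r)))

module _ (G : Graph) where

  Edge-sym : ∀ {u v} → Edge G u v → Edge G v u
  Edge-sym {u} {v} e = trans (Graph.sym G v u) e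

  neighbours≤Δ : ∀ {x ws} → Unique ws → All (Edge G x) ws → length ws ≤ Δ G
  neighbours≤Δ {x} {ws} ws! adjacent = begin
    length ws                                          ≤⟨ length-≤ ws! ws⊆ ⟩
    length (filter (T? ∘ adj G x) (allFin (n G)))      ≡⟨ count≡length-filter (adj G x) (allFin (n G)) ⟨
    degree G x                                         ≤⟨ ≤-foldr-⊔ (∈-map⁺ (degree G) (∈-allFin x)) ⟩
    Δ G                                                ∎
    where
    open ≤-Reasoning
    ws⊆ : ∀ {w} → w ∈ ws → w ∈ filter (T? ∘ adj G x) (allFin (n G))
    ws⊆ {w} w∈ = ∈-filter⁺ (T? ∘ adj G x) (∈-allFin w) (subst T (sym (All.lookup adjacent w∈)) _)

  walks : Connected G → ∀ u v → ∃ λ p → Linked (Edge G) (u ∷ p) × last (u ∷ p) ≡ just v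
  walks (_ , joined) u v with joined u v
  ... | (.u ∷ p) , (_ , linked) , refl , ends = p , linked , ends

module Embedding (G₁ G₂ : Graph) where

  open Grid (Edge G₂) (Edge-sym G₂) (n G₁)

  □hamiltonian : Traceable G₁ → HamiltonianGrid → □Hamiltonian G₁ G₂
  □hamiltonian ([] , () , _)
  □hamiltonian (q@(x ∷ _) , (q! , q-linked) , spanning) H =
    map place (vertices cycle) , IsCycle-map place step injective (isCycle cycle) , covered
    where
    open HamiltonianGrid H

    length-q : length q ≡ n G₁
    length-q = ≤-antisym
      (≤-trans (length-≤ q! (λ {v} _ → ∈-allFin v)) (≤-reflexive (length-tabulate id)))
      (≤-trans (≤-reflexive (sym (length-tabulate id)))
               (length-≤ (Unique.allFin⁺ (n G₁)) (λ {v} _ → spanning v)))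

    place : Cell → Fin (n G₁) × Fin (n G₂)
    place (i , u) = nthOr x q i , u

    in-q : ∀ {i} → i < n G₁ → i < length q
    in-q = subst (_ <_) (sym length-q)

    step : ∀ {a b} → a ~ b → □Edge G₁ G₂ (place a) (place b)
    step (across e)   = inj₁ (refl , e)
    step (down i+1<m) = inj₂ (refl , nthOr-linked x q-linked (in-q i+1<m))
    step (up i+1<m)   = inj₂ (refl , Edge-sym G₁ (nthOr-linked x q-linked (in-q i+1<m)))

    injective : ∀ {a b} → a ∈ vertices cycle → b ∈ vertices cycle → place a ≡ place b → a ≡ b
    injective {i , u} {j , w} a∈ b∈ e
      with nthOr-injective x q! (in-q (rows< a∈)) (in-q (rows< b∈)) (cong proj₁ e) | cong proj₂ e
    ... | refl | refl = refl

    covered : Spanning (map place (vertices cycle))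
    covered (v , u) with nthOr-surjective x (spanning v)
    ... | i , i<q , refl = ∈-map⁺ place (complete u (subst (i <_) length-q i<q))

module MatchingCase (G₁ G₂ : Graph) (connected : Connected G₂) (r : ℕ) (n≡ : n G₁ ≡ suc r) (1≤r : 1 ≤ r)
                    (Δ≤n : Δ G₂ ≤ n G₁) where

  open Grid (Edge G₂) (Edge-sym G₂) (n G₁) using (HamiltonianGrid)
  open Merging Fin._≟_ (Edge G₂) (Edge-sym G₂) (walks G₂ connected) (Δ G₂) (neighbours≤Δ G₂) (n G₁)
               ⊤ (λ _ i → i < r) (λ _ _ → upTo r) (λ _ _ i∈ → ∈-upTo⁻ i∈ , ∈-upTo⁻ i∈)
               (λ _ _ → Unique.upTo⁺ r)
               (λ _ _ → subst (Δ G₂ ≤_) (trans n≡ (cong suc (sym (length-upTo r)))) Δ≤n)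

  matching-blocks : ∀ {ps} → All (λ p → IsPath (Edge G₂) p × length p ≡ 2) ps →
                    ∃ λ Bs → columnsOf Bs ≡ concat ps
  matching-blocks [] = [] , refl
  matching-blocks {[] ∷ _}              ((() , _) ∷ _)
  matching-blocks {(_ ∷ []) ∷ _}        ((_ , ()) ∷ _)
  matching-blocks {(_ ∷ _ ∷ _ ∷ _) ∷ _} ((_ , ()) ∷ _)
  matching-blocks {(a ∷ b ∷ []) ∷ _}    (((((a≢b ∷ []) ∷ _) , ab ∷ [-]) , _) ∷ rest)
    with matching-blocks rest
  ... | Bs , eq = ladder-block ab a≢b r n≡ 1≤r tt id ∷ Bs , cong (λ cs → a ∷ b ∷ cs) eq

  hamiltonian : PerfectMatching G₂ → HamiltonianGrid
  hamiltonian (ps , paths , ps! , spanning) with matching-blocks paths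
  ... | Bs , eq = hamiltonian-grid (proj₁ connected) Bs (subst Unique (sym eq) ps!)
                                   (λ u → subst (u ∈_) (sym eq) (spanning u))

module PathFactorCase (G₁ G₂ : Graph) (connected : Connected G₂) (h D : ℕ) (n≡ : n G₁ ≡ twice (suc h))
                      (D+D≤h : D + D ≤ h) (Δ≤ : Δ G₂ ≤ suc D) where

  data Role : Set where
    paired lowEnd centre highEnd : Role

  -- Any two roles serve a common class of D rows. The high odd rows 2(D + t) + 1 stay below the
  -- top row because 2D ≤ h: this is where 4Δ - 2 ≤ |V(G₁)| is needed.
  data RowClass : Set where
    even lowOdd highOdd : RowClass

  classRow : RowClass → ℕ → ℕ
  classRow even    t = twice t
  classRow lowOdd  t = suc (twice t)
  classRow highOdd t = suc (twice (D + t))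

  classRows : RowClass → List ℕ
  classRows k = applyUpTo (classRow k) D

  data Serves : Role → RowClass → Set where
    paired-any   : ∀ {k} → Serves paired k
    lowEnd-even  : Serves lowEnd even
    lowEnd-odd   : Serves lowEnd lowOdd
    centre-low   : Serves centre lowOdd
    centre-high  : Serves centre highOdd
    highEnd-even : Serves highEnd even
    highEnd-odd  : Serves highEnd highOdd

  Offers : Role → ℕ → Set
  Offers r i = ∃ λ k → Serves r k × i ∈ classRows k

  common : ∀ r r′ → ∃ λ k → Serves r k × Serves r′ k
  common paired  paired  = even , paired-any , paired-any
  common paired  lowEnd  = even , paired-any , lowEnd-even
  common paired  centre  = lowOdd , paired-any , centre-low
  common paired  highEnd = even , paired-any , highEnd-even
  common lowEnd  paired  = even , lowEnd-even , paired-any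
  common lowEnd  lowEnd  = even , lowEnd-even , lowEnd-even
  common lowEnd  centre  = lowOdd , lowEnd-odd , centre-low
  common lowEnd  highEnd = even , lowEnd-even , highEnd-even
  common centre  paired  = lowOdd , centre-low , paired-any
  common centre  lowEnd  = lowOdd , centre-low , lowEnd-odd
  common centre  centre  = lowOdd , centre-low , centre-low
  common centre  highEnd = highOdd , centre-high , highEnd-odd
  common highEnd paired  = even , highEnd-even , paired-any
  common highEnd lowEnd  = even , highEnd-even , lowEnd-even
  common highEnd centre  = highOdd , highEnd-odd , centre-high
  common highEnd highEnd = even , highEnd-even , highEnd-even

  shared : Role → Role → List ℕ
  shared r r′ = classRows (proj₁ (common r r′))

  shared-offered : ∀ r r′ {i} → i ∈ shared r r′ → Offers r i × Offers r′ i
  shared-offered r r′ i∈ with common r r′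
  ... | k , s , s′ = (k , s , i∈) , (k , s′ , i∈)

  classRow-mono : ∀ k {s t} → s < t → classRow k s < classRow k t
  classRow-mono even    s<t = twice-mono-< s<t
  classRow-mono lowOdd  s<t = s≤s (twice-mono-< s<t)
  classRow-mono highOdd s<t = s≤s (twice-mono-< (+-monoʳ-< D s<t))

  length-classRows : ∀ k → length (classRows k) ≡ D
  length-classRows k = length-applyUpTo (classRow k) D

  classRows-unique : ∀ k → Unique (classRows k)
  classRows-unique k = Unique.applyUpTo⁺₁ (classRow k) D (λ s<t _ → <⇒≢ (classRow-mono k s<t))

  low<h : ∀ {t} → t < D → t < h
  low<h t<D = <-≤-trans t<D (≤-trans (m≤m+n D D) D+D≤h)

  low<h+1 : ∀ {t} → t < D → t < suc h
  low<h+1 = m<n⇒m<1+n ∘ low<h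

  high<h : ∀ {t} → t < D → D + t < h
  high<h t<D = <-≤-trans (+-monoʳ-< D t<D) D+D≤h

  classRow<top : ∀ k {t} → t < D → classRow k t < suc (twice h)
  classRow<top even    t<D = s≤s (twice-mono-≤ (<⇒≤ (low<h t<D)))
  classRow<top lowOdd  t<D = s≤s (twice-mono-< (low<h t<D))
  classRow<top highOdd t<D = s≤s (twice-mono-< (high<h t<D))

  shared-enough : ∀ r r′ → Δ G₂ ≤ suc (length (shared r r′))
  shared-enough r r′ = subst (λ l → Δ G₂ ≤ suc l) (sym (length-classRows (proj₁ (common r r′)))) Δ≤

  open Grid (Edge G₂) (Edge-sym G₂) (n G₁)
    using (HamiltonianGrid; Vertical; cells; vertices; module ThreeColumns)
  open Merging Fin._≟_ (Edge G₂) (Edge-sym G₂) (walks G₂ connected) (Δ G₂) (neighbours≤Δ G₂) (n G₁)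
               Role Offers shared shared-offered (λ r r′ → classRows-unique (proj₁ (common r r′)))
               shared-enough

  offered<top : ∀ {r i} → Offers r i → i < suc (twice h)
  offered<top (k , _ , i∈) with ∈-applyUpTo⁻ (classRow k) i∈
  ... | t , t<D , refl = classRow<top k t<D

  pair-block : ∀ {a b} → Edge G₂ a b → a ≢ b → Block
  pair-block ab a≢b = ladder-block ab a≢b (suc (twice h)) n≡ (s≤s z≤n) paired offered<top

  triple-block : ∀ {a b c} → Edge G₂ a b → Edge G₂ b c → a ≢ b → b ≢ c → a ≢ c → Block
  triple-block {a} {b} {c} ab bc a≢b b≢c a≢c = record
    { columns = triple
    ; anchor  = a
    ; anchor∈ = here refl
    ; cycle   = cycle
    ; ↭cells  = subst (λ k → vertices cycle ↭ cells k triple) (sym n≡) ↭cells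
    ; role    = role
    ; partner = λ where
        (here refl)                 → b , there (here refl) , ab
        (there (here refl))         → a , here refl , Edge-sym G₂ ab
        (there (there (here refl))) → b , there (here refl) , Edge-sym G₂ bc
    ; offered = offered
    }
    where
    open ThreeColumns ab bc a≢b b≢c a≢c D
    open Braid (braid h (subst (suc (twice h) <_) (sym n≡) (n<1+n _)))

    role : ∀ {u} → u ∈ triple → Role
    role (here refl)                 = lowEnd
    role (there (here refl))         = centre
    role (there (there (here refl))) = highEnd

    offered : ∀ {u} (u∈ : u ∈ triple) {i} → Offers (role u∈) i → Vertical cycle i u
    offered u∈ (k , s , i∈) with ∈-applyUpTo⁻ (classRow k) i∈
    offered (here refl)                 (_ , lowEnd-even , _)  | t , t<D , refl = even-a (low<h+1 t<D)
    offered (here refl)                 (_ , lowEnd-odd , _)   | t , t<D , refl = odd-a (low<h t<D) t<D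
    offered (there (here refl))         (_ , centre-low , _)   | t , t<D , refl = odd-b (low<h t<D)
    offered (there (here refl))         (_ , centre-high , _)  | t , t<D , refl = odd-b (high<h t<D)
    offered (there (there (here refl))) (_ , highEnd-even , _) | t , t<D , refl = even-c (low<h+1 t<D)
    offered (there (there (here refl))) (_ , highEnd-odd , _)  | t , t<D , refl = odd-c (high<h t<D) (m≤m+n _ _)

  path-blocks : ∀ {p} → Unique p → Linked (Edge G₂) p → 2 ≤ length p → ∃ λ Bs → columnsOf Bs ≡ p
  path-blocks {[]}                 _                _               ()
  path-blocks {_ ∷ []}             _                _               (s≤s ())
  path-blocks {a ∷ b ∷ []}         ((a≢b ∷ []) ∷ _) (ab ∷ [-])      _ = [ pair-block ab a≢b ] , refl
  path-blocks {a ∷ b ∷ c ∷ []}     ((a≢b ∷ a≢c ∷ []) ∷ (b≢c ∷ []) ∷ _) (ab ∷ bc ∷ [-]) _ =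
    [ triple-block ab bc a≢b b≢c a≢c ] , refl
  path-blocks {a ∷ b ∷ _ ∷ _ ∷ _} ((a≢b ∷ _) ∷ _ ∷ rest!) (ab ∷ _ ∷ rest) _
    with path-blocks rest! rest (s≤s (s≤s z≤n))
  ... | Bs , eq = pair-block ab a≢b ∷ Bs , cong (λ cs → a ∷ b ∷ cs) eq

  factor-blocks : ∀ {ps} → All (λ p → IsPath (Edge G₂) p × 2 ≤ length p) ps →
                  ∃ λ Bs → columnsOf Bs ≡ concat ps
  factor-blocks [] = [] , refl
  factor-blocks {[] ∷ _}      ((() , _) ∷ _)
  factor-blocks {(_ ∷ _) ∷ _} (((p! , linked) , 2≤p) ∷ rest)
    with path-blocks p! linked 2≤p | factor-blocks rest
  ... | Bs , eq | Cs , eq′ = Bs ++ Cs , trans (concatMap-++ Block.columns Bs Cs) (cong₂ _++_ eq eq′)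

  hamiltonian : PathFactor G₂ → HamiltonianGrid
  hamiltonian (ps , paths , ps! , spanning) with factor-blocks paths
  ... | Bs , eq = hamiltonian-grid (proj₁ connected) Bs (subst Unique (sym eq) ps!)
                                   (λ u → subst (u ∈_) (sym eq) (spanning u))

2≤⇒suc : ∀ {k} → 2 ≤ k → ∃ λ r → k ≡ suc r × 1 ≤ r
2≤⇒suc (s≤s (s≤s _)) = _ , refl , s≤s z≤n

even-order : ∀ {k} d → 2 ≤ k → 2 ∣ k → 4 * d ∸ 2 ≤ k → ∃ λ h → k ≡ twice (suc h) × (d ∸ 1) + (d ∸ 1) ≤ h
even-order _       (s≤s (s≤s _)) (divides zero    ())
even-order zero    _             (divides (suc h) k≡) _      = h , trans k≡ (sym (twice≡*2 (suc h))) , z≤n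
even-order (suc e) _             (divides (suc h) k≡) 4d∸2≤k = h , trans k≡ (sym (twice≡*2 (suc h))) ,
  ≤-pred (*-cancelʳ-≤ (suc (e + e)) (suc h) 2
           (≤-trans (≤-reflexive rows) (≤-trans 4d∸2≤k (≤-reflexive k≡))))
  where
  identity : ∀ e → 2 + 4 * e ≡ suc (e + e) * 2
  identity = solve-∀
  rows : suc (e + e) * 2 ≡ 4 * suc e ∸ 2
  rows = trans (sym (identity e)) (cong (_∸ 2) (sym (*-suc 4 e)))

theorem1p2 : (G₁ G₂ : Graph) → Traceable G₁ → 2 ≤ ∣V∣ G₁ → Connected G₂ →
    ((PerfectMatching G₂ × Δ G₂ ≤ ∣V∣ G₁) ⊎
     (PathFactor G₂ × 2 ∣ ∣V∣ G₁ × 4 * Δ G₂ ∸ 2 ≤ ∣V∣ G₁)) →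
    □Hamiltonian G₁ G₂
theorem1p2 G₁ G₂ traceable 2≤n connected (inj₁ (matching , Δ≤n))
  with 2≤⇒suc 2≤n
... | r , n≡ , 1≤r =
  Embedding.□hamiltonian G₁ G₂ traceable (MatchingCase.hamiltonian G₁ G₂ connected r n≡ 1≤r Δ≤n matching)
theorem1p2 G₁ G₂ traceable 2≤n connected (inj₂ (factor , 2∣n , 4Δ∸2≤n))
  with even-order (Δ G₂) 2≤n 2∣n 4Δ∸2≤n
... | h , n≡ , D+D≤h =
  Embedding.□hamiltonian G₁ G₂ traceable
    (PathFactorCase.hamiltonian G₁ G₂ connected h (Δ G₂ ∸ 1) n≡ D+D≤h (m≤n+m∸n (Δ G₂) 1) factor)
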